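{- Let $D$ be a digraph rooted at $r$, let $v\in V(D)\setminus\{r\}$, and let $L\subseteq D$ be $v$-large. Then for every $I\in\mathcal{G}_L(v)$ there is an $(r,v)$-path-system $\mathcal{P}$ in $L$ such that the set $\mathcal{P}'$ obtained from $\mathcal{P}$ by removing the one-edge path $rv$ (if present) satisfies $\mathcal{P}'\in\mathfrak{P}_D(v)\cap\mathfrak{P}_L(v)$, and $I\subseteq E^+(\mathcal{P})$.
   Context: Digraphs have no loops or parallel edges; $H-rv$ means $H$ if $rv\notin E(H)$. An $(r,v)$-path-system is a set of pairwise internally disjoint directed paths from $r$ to $v$; $E^+(\mathcal{P})$ is the set of last edges of the paths in $\mathcal{P}$. For a digraph $H$, $\mathcal{G}_H(v)$ is the set of all $I\subseteq\mathrm{in}_H(v)$ (edges with head $v$) with $I=E^+(\mathcal{P})$ for some $(r,v)$-path-system $\mathcal{P}$ in $H$. An $(r,v)$-separation is a set $S\subseteq V\setminus\{r,v\}$ meeting every $(r,v)$-path. A set of paths $\mathcal P$ and a vertex set $S$ are orthogonal if $|V(P)\cap S|=1$ for all $P\in\mathcal P$ and $S\subseteq\bigcup_{P\in\mathcal P}V(P)$. $\mathfrak{P}_H(v)$ is the set of $(r,v)$-path-systems in $H-rv$ orthogonal to some $(r,v)$-separation of $H-rv$. A spanning subdigraph $L\subseteq D$ is $v$-large (with respect to $D$) if some $\mathcal{P}\in\mathfrak{P}_D(v)$ has all its paths in $L$, and $rv\in E(L)$ whenever $rv\in E(D)$. -}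

module Defs where

open import Level using (0ℓ)
open import Data.Nat using (ℕ)
open import Data.Fin using (Fin; _≟_)
open import Data.Bool using (Bool; true; false)
open import Data.Product using (Σ; ∃; _×_; _,_)
open import Data.Sum using (_⊎_)
open import Data.List using (List; []; _∷_; _++_; filter)
open import Data.List.Properties using (≡-dec)
open import Data.List.Membership.Propositional using (_∈_)
open import Data.List.Relation.Unary.All using (All)
open import Data.List.Relation.Unary.Any using (Any)
open import Data.List.Relation.Unary.AllPairs using (AllPairs)
open import Data.List.Relation.Unary.Unique.Propositional using (Unique)
open import Data.List.Relation.Unary.Linked using (Linked)
open import Relation.Nullary using (¬_; ¬?)
open import Relation.Binary.PropositionalEquality using (_≡_; _≢_)
open import Relation.Unary using (Pred)

-- A finite digraph on vertex set Fin n: adjacency given by a Boolean matrix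
-- (hence no parallel edges), with no loops.
record Digraph (n : ℕ) : Set where
  field
    adj      : Fin n → Fin n → Bool
    loopless : ∀ x → adj x x ≡ false
open Digraph public

-- Edge relations (an edge is identified with its ordered pair (tail, head)).
ERel : ℕ → Set₁
ERel n = Fin n → Fin n → Set

Edge : ∀ {n} → Digraph n → ERel n
Edge H x y = adj H x y ≡ true

_∖e_ : ∀ {n} → ERel n → Fin n × Fin n → ERel n
(E ∖e (r , v)) x y = E x y × ¬ (x ≡ r × y ≡ v)

_⊆D_ : ∀ {n} → Digraph n → Digraph n → Set
L ⊆D D = ∀ x y → Edge L x y → Edge D x y

record IsPath {n : ℕ} (E : ERel n) (r v : Fin n) (p : List (Fin n)) : Set where
  field
    distinct : Unique p
    start    : ∃ λ rest → p ≡ r ∷ rest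
    end      : ∃ λ init → p ≡ init ++ (v ∷ [])
    edges    : Linked E p

InternallyDisjoint : ∀ {n} → Fin n → Fin n → List (Fin n) → List (Fin n) → Set
InternallyDisjoint r v p q = ∀ x → x ∈ p → x ∈ q → x ≡ r ⊎ x ≡ v

PathSystem : ∀ {n} → ERel n → Fin n → Fin n → List (List (Fin n)) → Set
PathSystem E r v P =
  All (IsPath E r v) P × AllPairs (λ p q → p ≢ q × InternallyDisjoint r v p q) P

EndsWith : ∀ {n} → List (Fin n) → Fin n × Fin n → Set
EndsWith p (u , w) = ∃ λ init → p ≡ init ++ (u ∷ w ∷ [])

E⁺ : ∀ {n} → List (List (Fin n)) → Pred (Fin n × Fin n) 0ℓ
E⁺ P e = Any (λ p → EndsWith p e) P

EdgeSet : ℕ → Set₁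
EdgeSet n = Pred (Fin n × Fin n) 0ℓ

VSet : ℕ → Set₁
VSet n = Pred (Fin n) 0ℓ

_⊆E_ : ∀ {n} → EdgeSet n → EdgeSet n → Set
I ⊆E J = ∀ e → I e → J e

InEdges : ∀ {n} → Digraph n → Fin n → EdgeSet n
InEdges H v (u , w) = Edge H u w × w ≡ v

𝒢 : ∀ {n} → Digraph n → Fin n → Fin n → EdgeSet n → Set
𝒢 H r v I =
  I ⊆E InEdges H v ×
  ∃ λ P → PathSystem (Edge H) r v P × (I ⊆E E⁺ P) × (E⁺ P ⊆E I)

Separation : ∀ {n} → ERel n → Fin n → Fin n → VSet n → Set
Separation E r v S =
  (∀ x → S x → x ≢ r × x ≢ v) ×
  (∀ p → IsPath E r v p → ∃ λ x → x ∈ p × S x)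

Orthogonal : ∀ {n} → List (List (Fin n)) → VSet n → Set
Orthogonal P S =
  All (λ p → ∃ λ x → x ∈ p × S x × (∀ y → y ∈ p → S y → y ≡ x)) P ×
  (∀ x → S x → Any (λ p → x ∈ p) P)

𝔓 : ∀ {n} → Digraph n → Fin n → Fin n → List (List (Fin n)) → Set₁
𝔓 H r v P =
  PathSystem (Edge H ∖e (r , v)) r v P ×
  Σ (VSet _) λ S → Separation (Edge H ∖e (r , v)) r v S × Orthogonal P S

Large : ∀ {n} → Digraph n → Digraph n → Fin n → Fin n → Set₁
Large D L r v =
  L ⊆D D ×
  (∃ λ P → 𝔓 D r v P × All (Linked (Edge L)) P) ×
  (Edge D r v → Edge L r v)

removeRV : ∀ {n} → Fin n → Fin n → List (List (Fin n)) → List (List (Fin n))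
removeRV r v = filter (λ p → ¬? (≡-dec _≟_ p (r ∷ v ∷ [])))

-- Removing the one-edge path rv from a path-system of L realising I leaves an (r,v)-path-system
-- Q₀ of L − rv. Splitting off a sink copy of every in-neighbour of v turns (r,v)-path-systems
-- of L − rv into families of disjoint paths from the out-neighbours of r to the sinks, with last
-- edges becoming end vertices. The augmenting step of Menger's theorem enlarges such a family
-- while keeping its ends, so Q₀ grows to an (r,v)-path-system Q′ of L − rv with the same last
-- edges and at least as many paths as the system P₀ ∈ 𝔓_D(v) lying in L. The separation S
-- orthogonal to P₀ has |P₀| vertices, every path of Q′ meets S, and distinct paths meet it in
-- distinct vertices, so by pigeonhole Q′ is orthogonal to S; as S also separates r from v in
-- L − rv ⊆ D − rv, Q′ lies in 𝔓_D(v) ∩ 𝔓_L(v). Finally rv is put back when it is an edge of L.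

{-# OPTIONS --safe #-}
module Submission where

open import Level using (0ℓ)
open import Data.Bool using (true; false)
open import Data.Empty using (⊥; ⊥-elim)
open import Data.Fin using (Fin) renaming (_≟_ to _≟ᶠ_)
open import Data.List using (List; []; _∷_; _++_; [_]; _∷ʳ_; length; map)
open import Data.List.Properties
  using (++-assoc; map-++; length-++; length-++-sucʳ; length-map; ∷-injective; ∷ʳ-injective; ≡-dec;
         filter-all; filter-reject)
open import Data.List.Membership.Propositional using (_∈_; _∉_; find; lose)
open import Data.List.Membership.Propositional.Properties
  using (∈-∃++; ∈-++⁻; ∈-++⁺ˡ; ∈-++⁺ʳ; ∈-insert; ∈-map⁺; ∈-map⁻; ∈-filter⁺)
open import Data.List.Relation.Binary.Disjoint.Propositional using (Disjoint)
import Data.List.Relation.Binary.Disjoint.Propositional.Properties as Disjoint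
open import Data.List.Relation.Binary.Pointwise using (Pointwise; []; _∷_; Pointwise-length; AllPairs-resp-Pointwise)
open import Data.List.Relation.Binary.Subset.Propositional using (_⊆_; _⊇_)
open import Data.List.Relation.Unary.All as All using (All; []; _∷_)
import Data.List.Relation.Unary.All.Properties as Allₚ
open import Data.List.Relation.Unary.AllPairs as AllPairs using (AllPairs; []; _∷_)
import Data.List.Relation.Unary.AllPairs.Properties as AllPairsₚ
open import Data.List.Relation.Unary.Any as Any using (Any; here; there)
import Data.List.Relation.Unary.Any.Properties as Anyₚ
open import Data.List.Relation.Unary.Linked as Linked using (Linked; []; [-]; _∷_)
open import Data.List.Relation.Unary.Unique.Propositional using (Unique)
import Data.List.Relation.Unary.Unique.Propositional.Properties as Unique
open import Data.Nat using (ℕ; zero; suc; _+_; _<_; _≤_; _≤?_; s≤s; z≤n)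
open import Data.Nat.Induction using (<-wellFounded)
open import Data.Nat.ListAction using (sum)
open import Data.Nat.Properties using (+-monoʳ-<; +-monoˡ-<; ≰⇒>; +-suc; m≤m+n; <⇒≱; ≤-trans; ≤-reflexive; n<1+n)
open import Data.Product using (Σ; ∃; ∃₂; _×_; _,_; proj₁; proj₂) renaming (map₂ to ×-map₂)
open import Data.Sum using (_⊎_; inj₁; inj₂)
open import Data.Sum.Properties using (inj₁-injective; inj₂-injective) renaming (≡-dec to ⊎-≡-dec)
open import Data.Unit using (⊤; tt)
open import Function using (_∘_; _$_; _on_)
open import Induction.WellFounded using (Acc; acc)
open import Relation.Binary.Definitions using (DecidableEquality; _Respects₂_)
open import Relation.Binary.PropositionalEquality using (_≡_; _≢_; refl; sym; trans; cong; cong₂; subst; subst₂)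
open import Relation.Nullary using (¬_; ¬?; Dec; yes; no)
open import Relation.Nullary.Decidable using (_⊎-dec_)
open import Relation.Unary using (Pred; Decidable; ∁; _∪_)

open import Defs

module _ {A : Set} where

  Unique-++⁻ˡ : ∀ (xs : List A) {ys} → Unique (xs ++ ys) → Unique xs
  Unique-++⁻ˡ []       _          = []
  Unique-++⁻ˡ (x ∷ xs) (x∉ ∷ uniq) = Allₚ.++⁻ˡ xs x∉ ∷ Unique-++⁻ˡ xs uniq

  Unique-++⁻ʳ : ∀ (xs : List A) {ys} → Unique (xs ++ ys) → Unique ys
  Unique-++⁻ʳ []       uniq       = uniq
  Unique-++⁻ʳ (x ∷ xs) (_ ∷ uniq) = Unique-++⁻ʳ xs uniq

  Unique-++⇒Disjoint : ∀ (xs : List A) {ys} → Unique (xs ++ ys) → Disjoint xs ys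
  Unique-++⇒Disjoint (x ∷ xs) (x∉ ∷ _)    (here refl , z∈ys) = All.lookup (Allₚ.++⁻ʳ xs x∉) z∈ys refl
  Unique-++⇒Disjoint (x ∷ xs) (_ ∷ uniq) (there z∈xs , z∈ys) = Unique-++⇒Disjoint xs uniq (z∈xs , z∈ys)

  ∈-++-∷⁺ : ∀ (xs : List A) {y ys z} → z ∈ xs ++ ys → z ∈ xs ++ y ∷ ys
  ∈-++-∷⁺ xs z∈ with ∈-++⁻ xs z∈
  ... | inj₁ z∈xs = ∈-++⁺ˡ z∈xs
  ... | inj₂ z∈ys = ∈-++⁺ʳ xs (there z∈ys)

  Any-++-∷⁻ : ∀ {P : Pred A 0ℓ} (xs : List A) {y ys} → Any P (xs ++ y ∷ ys) → ¬ P y → Any P (xs ++ ys)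
  Any-++-∷⁻ []       (here py)  ¬py = ⊥-elim (¬py py)
  Any-++-∷⁻ []       (there p)  _   = p
  Any-++-∷⁻ (x ∷ xs) (here px)  _   = here px
  Any-++-∷⁻ (x ∷ xs) (there p)  ¬py = there (Any-++-∷⁻ xs p ¬py)

  Disjoint-⊆ˡ : ∀ {xs ys zs : List A} → xs ⊆ ys → Disjoint ys zs → Disjoint xs zs
  Disjoint-⊆ˡ xs⊆ys ys#zs (v∈xs , v∈zs) = ys#zs (xs⊆ys v∈xs , v∈zs)

  Disjoint-++ˡ : ∀ {xs ys zs : List A} → Disjoint xs zs → Disjoint ys zs → Disjoint (xs ++ ys) zs
  Disjoint-++ˡ {xs} xs#zs ys#zs (v∈ , v∈zs) with ∈-++⁻ xs v∈
  ... | inj₁ v∈xs = xs#zs (v∈xs , v∈zs)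
  ... | inj₂ v∈ys = ys#zs (v∈ys , v∈zs)

  Disjoint-++ʳ : ∀ {xs ys zs : List A} → Disjoint xs ys → Disjoint xs zs → Disjoint xs (ys ++ zs)
  Disjoint-++ʳ {ys = ys} xs#ys xs#zs (v∈xs , v∈) with ∈-++⁻ ys v∈
  ... | inj₁ v∈ys = xs#ys (v∈xs , v∈ys)
  ... | inj₂ v∈zs = xs#zs (v∈xs , v∈zs)

  All-++-∷⁻ : ∀ {P : Pred A 0ℓ} (xs : List A) {y zs} → All P (xs ++ y ∷ zs) → P y × All P (xs ++ zs)
  All-++-∷⁻ xs ps with Allₚ.++⁻ xs ps
  ... | ps₁ , (py ∷ ps₂) = py , Allₚ.++⁺ ps₁ ps₂

  All-++-∷⁺ : ∀ {P : Pred A 0ℓ} (xs : List A) {y zs} → P y → All P (xs ++ zs) → All P (xs ++ y ∷ zs)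
  All-++-∷⁺ xs py ps with Allₚ.++⁻ xs ps
  ... | ps₁ , ps₂ = Allₚ.++⁺ ps₁ (py ∷ ps₂)

  last-two-injective : ∀ (xs ys : List A) {a b c d} → xs ++ a ∷ b ∷ [] ≡ ys ++ c ∷ d ∷ [] → a ≡ c × b ≡ d
  last-two-injective xs ys {a} {b} {c} {d} eq
    with ∷ʳ-injective (xs ∷ʳ a) (ys ∷ʳ c) (trans (++-assoc xs [ a ] [ b ]) (trans eq (sym (++-assoc ys [ c ] [ d ]))))
  ... | init≡ , b≡d with ∷ʳ-injective xs ys init≡
  ... | _ , a≡c = a≡c , b≡d

  ∷-≡-∷ʳ : ∀ (init : List A) {x xs z} → x ∷ xs ≡ init ∷ʳ z → xs ≡ [] ⊎ z ∈ xs
  ∷-≡-∷ʳ []         eq = inj₁ (proj₂ (∷-injective eq))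
  ∷-≡-∷ʳ (_ ∷ init) eq = inj₂ (subst (_ ∈_) (sym (proj₂ (∷-injective eq))) (∈-insert init))

  lastSatisfying : ∀ {P : Pred A 0ℓ} → Decidable P → ∀ xs →
    All (∁ P) xs ⊎ ∃₂ λ xs₁ x → ∃ λ xs₂ → xs ≡ xs₁ ++ x ∷ xs₂ × P x × All (∁ P) xs₂
  lastSatisfying P? [] = inj₁ []
  lastSatisfying P? (x ∷ xs) with lastSatisfying P? xs
  ... | inj₂ (xs₁ , y , xs₂ , refl , py , none) = inj₂ (x ∷ xs₁ , y , xs₂ , refl , py , none)
  ... | inj₁ none with P? x
  ...   | yes px = inj₂ ([] , x , xs , refl , px , none)
  ...   | no ¬px = inj₁ (¬px ∷ none)

  module _ {R : A → A → Set} where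

    Linked-++⁻ˡ : ∀ (xs : List A) {ys} → Linked R (xs ++ ys) → Linked R xs
    Linked-++⁻ˡ []            _       = []
    Linked-++⁻ˡ (x ∷ [])      _       = [-]
    Linked-++⁻ˡ (x ∷ x′ ∷ xs) (r ∷ l) = r ∷ Linked-++⁻ˡ (x′ ∷ xs) l

    Linked-++⁻ʳ : ∀ (xs : List A) {ys} → Linked R (xs ++ ys) → Linked R ys
    Linked-++⁻ʳ []       l = l
    Linked-++⁻ʳ (x ∷ xs) l = Linked-++⁻ʳ xs (Linked.tail l)

    Linked-glue : ∀ (xs : List A) {z ys} → Linked R (xs ++ [ z ]) → Linked R (z ∷ ys) → Linked R (xs ++ z ∷ ys)
    Linked-glue []            _       l = l
    Linked-glue (x ∷ [])      (r ∷ _) l = r ∷ l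
    Linked-glue (x ∷ x′ ∷ xs) (r ∷ l₁) l = r ∷ Linked-glue (x′ ∷ xs) l₁ l

  module _ {R : A → A → Set} (R-sym : ∀ {a b} → R a b → R b a) where

    AllPairs-++-∷⁻ : ∀ (xs : List A) {y zs} → AllPairs R (xs ++ y ∷ zs) → All (R y) (xs ++ zs) × AllPairs R (xs ++ zs)
    AllPairs-++-∷⁻ []       (ry ∷ rs) = ry , rs
    AllPairs-++-∷⁻ (x ∷ xs) (rx ∷ rs) with AllPairs-++-∷⁻ xs rs | Allₚ.++⁻ xs rx
    ... | ry , rs′ | rx₁ , (rxy ∷ rx₂) = R-sym rxy ∷ ry , Allₚ.++⁺ rx₁ rx₂ ∷ rs′

    AllPairs-++-∷⁺ : ∀ (xs : List A) {y zs} → All (R y) (xs ++ zs) → AllPairs R (xs ++ zs) → AllPairs R (xs ++ y ∷ zs)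
    AllPairs-++-∷⁺ []       ry         rs        = ry ∷ rs
    AllPairs-++-∷⁺ (x ∷ xs) (ryx ∷ ry) (rx ∷ rs) with Allₚ.++⁻ xs rx
    ... | rx₁ , rx₂ = Allₚ.++⁺ rx₁ (R-sym ryx ∷ rx₂) ∷ AllPairs-++-∷⁺ xs ry rs

  Linked-zipWith : ∀ {R R′ R″ : A → A → Set} → (∀ {x y} → R x y → R′ x y → R″ x y) →
                   ∀ {xs} → Linked R xs → Linked R′ xs → Linked R″ xs
  Linked-zipWith f []       []         = []
  Linked-zipWith f [-]      [-]        = [-]
  Linked-zipWith f (r ∷ rs) (r′ ∷ rs′) = f r r′ ∷ Linked-zipWith f rs rs′

module _ {A B : Set} (f : A → B) where

  map-≡-++-∷ : ∀ (cs : List A) (ds₁ : List B) {d ds₂} → map f cs ≡ ds₁ ++ d ∷ ds₂ →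
    ∃₂ λ cs₁ c → ∃ λ cs₂ → cs ≡ cs₁ ++ c ∷ cs₂ × map f cs₁ ≡ ds₁ × f c ≡ d × map f cs₂ ≡ ds₂
  map-≡-++-∷ (c ∷ cs) []        eq with ∷-injective eq
  ... | fc≡d , eq′ = [] , c , cs , refl , refl , fc≡d , eq′
  map-≡-++-∷ (c ∷ cs) (d′ ∷ ds₁) eq with ∷-injective eq
  ... | fc≡d′ , eq′ with map-≡-++-∷ cs ds₁ eq′
  ...   | cs₁ , c′ , cs₂ , refl , eq₁ , eq₂ , eq₃ = c ∷ cs₁ , c′ , cs₂ , refl , cong₂ _∷_ fc≡d′ eq₁ , eq₂ , eq₃

module _ {A B : Set} {P : Pred A 0ℓ} (f : ∀ {x} → P x → B) where

  length-reduce : ∀ {xs} (pxs : All P xs) → length (All.reduce f pxs) ≡ length xs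
  length-reduce []         = refl
  length-reduce (px ∷ pxs) = cong suc (length-reduce pxs)

  ∈-reduce : ∀ {xs x} (pxs : All P xs) (x∈ : x ∈ xs) → f (All.lookup pxs x∈) ∈ All.reduce f pxs
  ∈-reduce (px ∷ pxs) (here refl) = here refl
  ∈-reduce (px ∷ pxs) (there x∈)  = there (∈-reduce pxs x∈)

  All-reduce : ∀ {Q : Pred B 0ℓ} → (∀ {x} (px : P x) → Q (f px)) → ∀ {xs} (pxs : All P xs) → All Q (All.reduce f pxs)
  All-reduce g []         = []
  All-reduce g (px ∷ pxs) = g px ∷ All-reduce g pxs

module Pigeonhole {V C : Set} (_∋_ : C → V → Set) where

  Meets : List V → C → Set
  Meets X c = Any (c ∋_) X

  SeparatedOn : List V → C → C → Set
  SeparatedOn X c d = ∀ {z} → z ∈ X → c ∋ z → d ∋ z → ⊥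

  SeparatedOn-sym : ∀ {X c d} → SeparatedOn X c d → SeparatedOn X d c
  SeparatedOn-sym c#d z∈X d∋z c∋z = c#d z∈X c∋z d∋z

  pigeonhole : ∀ {X} F → AllPairs (SeparatedOn X) F → All (Meets X) F → length F ≤ length X
  pigeonhole [] _ _ = z≤n
  pigeonhole {X} (c ∷ F) (c#F ∷ F#) (c∩X ∷ F∩X) with find c∩X
  ... | z , z∈X , c∋z with ∈-∃++ z∈X
  ... | X₁ , X₂ , refl =
    ≤-trans (s≤s (pigeonhole F (AllPairs.map shrink F#) (All.zipWith meet (c#F , F∩X))))
            (≤-reflexive (sym (length-++-sucʳ X₁ z X₂)))
    where
    shrink : ∀ {d d′} → SeparatedOn X d d′ → SeparatedOn (X₁ ++ X₂) d d′
    shrink sep w∈ = sep (∈-++-∷⁺ X₁ w∈)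
    meet : ∀ {d} → SeparatedOn X c d × Meets X d → Meets (X₁ ++ X₂) d
    meet (c#d , d∩X) = Any-++-∷⁻ X₁ d∩X (c#d z∈X c∋z)

  some-avoids : (∀ c → Decidable (c ∋_)) → ∀ X F → AllPairs (SeparatedOn X) F → length X < length F →
            Any (λ c → ¬ Meets X c) F
  some-avoids _∋?_ X F F# X<F = Allₚ.¬All⇒Any¬ (λ c → Any.any? (c ∋?_) X) F (λ meets → <⇒≱ X<F (pigeonhole F F# meets))

module Linkages {V : Set} (_≟_ : DecidableEquality V) (E : V → V → Set) (A : Pred V 0ℓ) where

  open import Data.List.Membership.DecPropositional _≟_ using (_∈?_)

  data EndsIn (B : Pred V 0ℓ) : List V → V → Set where
    stop : ∀ {y} → B y → EndsIn B [ y ] y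
    skip : ∀ {x xs y} → ¬ B x → EndsIn B xs y → EndsIn B (x ∷ xs) y

  StartsIn : List V → Set
  StartsIn []      = ⊥
  StartsIn (a ∷ _) = A a

  record PathTo (B : Pred V 0ℓ) (p : List V) (e : V) : Set where
    constructor pathTo
    field
      unique : Unique p
      linked : Linked E p
      endsIn : EndsIn B p e
  open PathTo

  Route : Set
  Route = List V × V

  ABPath : Pred V 0ℓ → Route → Set
  ABPath B (p , e) = StartsIn p × PathTo B p e

  Linkage : Pred V 0ℓ → List Route → Set
  Linkage B F = All (ABPath B) F × AllPairs (Disjoint on proj₁) F

  ends : List Route → List V
  ends = map proj₂

  totalLength : List Route → ℕ
  totalLength = sum ∘ map (length ∘ proj₁)

  Augmentation : Pred V 0ℓ → List Route → Set
  Augmentation B 𝒫 = ∃₂ λ N Qs → Linkage B (N ∷ Qs) × ends Qs ≡ ends 𝒫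

  StartsIn-++ : ∀ xs {y ys zs} → StartsIn (xs ++ y ∷ ys) → StartsIn (xs ++ y ∷ zs)
  StartsIn-++ []      s = s
  StartsIn-++ (_ ∷ _) s = s

  module _ {B : Pred V 0ℓ} {e : V} where

    EndsIn-∈ : ∀ {p} → EndsIn B p e → e ∈ p
    EndsIn-∈ (stop _)    = here refl
    EndsIn-∈ (skip _ en) = there (EndsIn-∈ en)

    EndsIn-target : ∀ {p} → EndsIn B p e → B e
    EndsIn-target (stop b)    = b
    EndsIn-target (skip _ en) = EndsIn-target en

    EndsIn-only : ∀ {p z} → EndsIn B p e → z ∈ p → B z → z ≡ e
    EndsIn-only (stop _)    (here refl) _ = refl
    EndsIn-only (skip ¬b _) (here refl) b = ⊥-elim (¬b b)
    EndsIn-only (skip _ en) (there z∈)  b = EndsIn-only en z∈ b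

    EndsIn-prefix : ∀ xs {y ys} → EndsIn B (xs ++ y ∷ ys) e → All (∁ B) xs
    EndsIn-prefix []            _            = []
    EndsIn-prefix (x ∷ [])      (skip ¬b _)  = ¬b ∷ []
    EndsIn-prefix (x ∷ x′ ∷ xs) (skip ¬b en) = ¬b ∷ EndsIn-prefix (x′ ∷ xs) en

    EndsIn-suffix : ∀ xs {y ys} → EndsIn B (xs ++ y ∷ ys) e → EndsIn B (y ∷ ys) e
    EndsIn-suffix []            en          = en
    EndsIn-suffix (x ∷ [])      (skip _ en) = en
    EndsIn-suffix (x ∷ x′ ∷ xs) (skip _ en) = EndsIn-suffix (x′ ∷ xs) en

    EndsIn-last : ∀ xs {x} → EndsIn B (xs ++ [ x ]) e → x ≡ e
    EndsIn-last []            (stop _)          = refl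
    EndsIn-last (_ ∷ [])      (skip _ (stop _)) = refl
    EndsIn-last (_ ∷ x′ ∷ xs) (skip _ en)       = EndsIn-last (x′ ∷ xs) en

    EndsIn-++⁺ : ∀ xs {l} → All (∁ B) xs → EndsIn B l e → EndsIn B (xs ++ l) e
    EndsIn-++⁺ []       []          en = en
    EndsIn-++⁺ (x ∷ xs) (¬b ∷ ¬bs)  en = skip ¬b (EndsIn-++⁺ xs ¬bs en)

    EndsIn-split : ∀ {p} → EndsIn B p e → ∃ λ xs → p ≡ xs ++ [ e ]
    EndsIn-split (stop _) = [] , refl
    EndsIn-split (skip {x} _ en) with EndsIn-split en
    ... | xs , refl = x ∷ xs , refl

  EndsIn-map : ∀ {B B′ p e} → (∀ {z} → z ∈ p → ¬ B z → ¬ B′ z) → B′ e → EndsIn B p e → EndsIn B′ p e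
  EndsIn-map f b′ (stop _)     = stop b′
  EndsIn-map f b′ (skip ¬b en) = skip (f (here refl) ¬b) (EndsIn-map (f ∘ there) b′ en)

  PathTo-suffix : ∀ xs {y ys B e} → PathTo B (xs ++ y ∷ ys) e → PathTo B (y ∷ ys) e
  PathTo-suffix xs (pathTo u l en) = pathTo (Unique-++⁻ʳ xs u) (Linked-++⁻ʳ xs l) (EndsIn-suffix xs en)

  PathTo-from : ∀ xs {ys y B e} → y ∈ ys → PathTo B (xs ++ ys) e → ∃ λ T → PathTo B (y ∷ T) e × y ∷ T ⊆ ys
  PathTo-from xs {y = y} {B} {e} y∈ys path with ∈-∃++ y∈ys
  ... | ys₁ , T , refl =
    T , PathTo-suffix (xs ++ ys₁) (subst (λ q → PathTo B q e) (sym (++-assoc xs ys₁ (y ∷ T))) path) , ∈-++⁺ʳ ys₁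

  ABPath-narrow : ∀ {B B′ p e} → (∀ {w} → B w → B′ w) → B e → ABPath B′ (p , e) → ABPath B (p , e)
  ABPath-narrow B⊆B′ b (s , pathTo u l en) = s , pathTo u l (EndsIn-map (λ _ ¬b′ → ¬b′ ∘ B⊆B′) b en)

  ABPath-widen : ∀ {B p e} (Z : List V) → Disjoint p Z → ABPath B (p , e) → ABPath (B ∪ (_∈ Z)) (p , e)
  ABPath-widen Z p#Z (s , pathTo u l en) =
    s , pathTo u l (EndsIn-map (λ { z∈p ¬b (inj₁ b) → ¬b b ; z∈p _ (inj₂ z∈Z) → p#Z (z∈p , z∈Z) })
                               (inj₁ (EndsIn-target en)) en)

  glue : ∀ {B} (Z : List V) U {z T e} → ABPath (B ∪ (_∈ Z)) (U ++ [ z ] , z) → PathTo B (z ∷ T) e →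
         z ∷ T ⊆ Z → ABPath B (U ++ z ∷ T , e)
  glue Z U (s , pathTo u l en) (pathTo uT lT enT) zT⊆Z =
    StartsIn-++ U s ,
    pathTo (Unique.++⁺ (Unique-++⁻ˡ U u) uT (λ (w∈U , w∈zT) → All.lookup U-off w∈U (inj₂ (zT⊆Z w∈zT))))
           (Linked-glue U l lT)
           (EndsIn-++⁺ U (All.map (_∘ inj₁) U-off) enT)
    where
    U-off = EndsIn-prefix U en

  module _ {B B′ : Pred V 0ℓ} (B′? : Decidable B′) (B⊆B′ : ∀ {w} → B w → B′ w) where

    cut : ∀ p {e} → EndsIn B p e → ∃₂ λ t rest → ∃ λ e′ → p ≡ t ++ rest × EndsIn B′ t e′
    cut (x ∷ xs) en with B′? x
    ... | yes b′ = [ x ] , xs , x , refl , stop b′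
    cut (x ∷ []) (stop b)    | no ¬b′ = ⊥-elim (¬b′ (B⊆B′ b))
    cut (x ∷ xs) (skip _ en) | no ¬b′ with cut xs en
    ... | t , rest , e′ , refl , en′ = x ∷ t , rest , e′ , refl , skip ¬b′ en′

    truncate : ∀ {p e} → ABPath B (p , e) → ∃₂ λ t e′ → ABPath B′ (t , e′) × t ⊆ p
    truncate {p} (s , pathTo u l en) with cut p en
    ... | [] , _ , _ , _ , ()
    ... | t@(_ ∷ _) , rest , e′ , refl , en′ =
      t , e′ , (s , pathTo (Unique-++⁻ˡ t u) (Linked-++⁻ˡ t l) en′) , ∈-++⁺ˡ

    truncate-all : ∀ {G} → All (ABPath B) G → ∃ λ F → All (ABPath B′) F × Pointwise (_⊇_ on proj₁) G F
    truncate-all []             = [] , [] , []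
    truncate-all (path ∷ paths) with truncate path | truncate-all paths
    ... | t , e′ , path′ , t⊆ | F , paths′ , pw = (t , e′) ∷ F , path′ ∷ paths′ , t⊆ ∷ pw

    truncate-linkage : ∀ {G} → Linkage B G → ∃ λ F → Linkage B′ F × length F ≡ length G
    truncate-linkage (paths , disjoint) with truncate-all paths
    ... | F , paths′ , pw =
      F , (paths′ , AllPairs-resp-Pointwise Disjoint-resp-⊇ pw disjoint) , sym (Pointwise-length pw)
      where
      Disjoint-resp-⊇ : (Disjoint on proj₁) Respects₂ (_⊇_ on proj₁)
      Disjoint-resp-⊇ = (λ sub d (v∈a , v∈b) → d (v∈a , sub v∈b)) , (λ sub d (v∈a , v∈b) → d (sub v∈a , v∈b))

  On : V → List Route → Set
  On w F = Any ((w ∈_) ∘ proj₁) F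

  On? : ∀ F w → Dec (On w F)
  On? F w = Any.any? (λ a → w ∈? proj₁ a) F

  totalLength-< : ∀ F₁ {a a′ F₂} → length (proj₁ a′) < length (proj₁ a) →
                  totalLength (F₁ ++ a′ ∷ F₂) < totalLength (F₁ ++ a ∷ F₂)
  totalLength-< []       {F₂ = F₂} lt = +-monoˡ-< (totalLength F₂) lt
  totalLength-< (b ∷ F₁)           lt = +-monoʳ-< (length (proj₁ b)) (totalLength-< F₁ lt)

  -- R meets 𝒫 for the last time at x on P = P₁ x P₂. Cutting P back to P₁ x and adding
  -- tails = x P₂ R₂ to the targets shortens 𝒫. In an augmentation of the shortened linkage one
  -- path Q ends at x and the new path Y at some y: if y lies on P₂, Q continues along R₂ and Y
  -- along the rest of P₂; otherwise Q continues along P₂ and Y, if y is on R₂, along the rest of R₂.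
  module Reroute
    {B : Pred V 0ℓ} (B? : Decidable B)
    (𝒫₁ 𝒫₂ : List Route) (P₁ P₂ : List V) (x e : V) (R₁ R₂ : List V) (eR : V)
    (𝒫-linkage : Linkage B (𝒫₁ ++ (P₁ ++ x ∷ P₂ , e) ∷ 𝒫₂))
    (R-path : ABPath B (R₁ ++ x ∷ R₂ , eR))
    (ends#R : Disjoint (ends (𝒫₁ ++ (P₁ ++ x ∷ P₂ , e) ∷ 𝒫₂)) (R₁ ++ x ∷ R₂))
    (R₂-off : All (λ w → ¬ On w (𝒫₁ ++ (P₁ ++ x ∷ P₂ , e) ∷ 𝒫₂)) R₂)
    where

    P : List V
    P = P₁ ++ x ∷ P₂

    𝒫 : List Route
    𝒫 = 𝒫₁ ++ (P , e) ∷ 𝒫₂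

    others : List Route
    others = 𝒫₁ ++ 𝒫₂

    P-path : ABPath B (P , e)
    P-path = proj₁ (All-++-∷⁻ 𝒫₁ (proj₁ 𝒫-linkage))

    others-paths : All (ABPath B) others
    others-paths = proj₂ (All-++-∷⁻ 𝒫₁ (proj₁ 𝒫-linkage))

    P#others : All (Disjoint P ∘ proj₁) others
    P#others = proj₁ (AllPairs-++-∷⁻ Disjoint.sym 𝒫₁ (proj₂ 𝒫-linkage))

    others# : AllPairs (Disjoint on proj₁) others
    others# = proj₂ (AllPairs-++-∷⁻ Disjoint.sym 𝒫₁ (proj₂ 𝒫-linkage))

    P≡ : P ≡ (P₁ ++ [ x ]) ++ P₂
    P≡ = sym (++-assoc P₁ [ x ] P₂)

    R≡ : R₁ ++ x ∷ R₂ ≡ (R₁ ++ [ x ]) ++ R₂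
    R≡ = sym (++-assoc R₁ [ x ] R₂)

    On-P : ∀ {w} → w ∈ P → On w 𝒫
    On-P w∈P = Any.map (λ { refl → w∈P }) (∈-insert 𝒫₁)

    On-others : ∀ {a w} → a ∈ others → w ∈ proj₁ a → On w 𝒫
    On-others a∈ w∈a = Any.map (λ { refl → w∈a }) (∈-++-∷⁺ 𝒫₁ a∈)

    R₂#P : Disjoint R₂ P
    R₂#P (w∈R₂ , w∈P) = All.lookup R₂-off w∈R₂ (On-P w∈P)

    x≢e : x ≢ e
    x≢e refl = ends#R (∈-map⁺ proj₂ (∈-insert 𝒫₁) , ∈-insert R₁)

    x∉P₂ : x ∉ P₂
    x∉P₂ x∈P₂ with Unique-++⁻ʳ P₁ (unique (proj₂ P-path))
    ... | x∉ ∷ _ = All.lookup x∉ x∈P₂ refl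

    tails : List V
    tails = (x ∷ P₂) ++ R₂

    B′ : Pred V 0ℓ
    B′ = B ∪ (_∈ tails)

    B′? : Decidable B′
    B′? w = B? w ⊎-dec (w ∈? tails)

    P₂⊆tails : P₂ ⊆ tails
    P₂⊆tails = ∈-++⁺ˡ ∘ there

    R₂⊆tails : R₂ ⊆ tails
    R₂⊆tails = ∈-++⁺ʳ (x ∷ P₂)

    xR₂⊆tails : x ∷ R₂ ⊆ tails
    xR₂⊆tails (here refl)  = here refl
    xR₂⊆tails (there w∈R₂) = R₂⊆tails w∈R₂

    xR₂#P₂ : Disjoint (x ∷ R₂) P₂
    xR₂#P₂ (here refl  , x∈P₂) = x∉P₂ x∈P₂
    xR₂#P₂ (there w∈R₂ , w∈P₂) = R₂#P (w∈R₂ , ∈-++⁺ʳ P₁ (there w∈P₂))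

    others#tails : ∀ {a} → a ∈ others → Disjoint (proj₁ a) tails
    others#tails a∈ (w∈a , w∈tails) with ∈-++⁻ (x ∷ P₂) w∈tails
    ... | inj₁ w∈xP₂ = All.lookup P#others a∈ (∈-++⁺ʳ P₁ w∈xP₂ , w∈a)
    ... | inj₂ w∈R₂  = All.lookup R₂-off w∈R₂ (On-others a∈ w∈a)

    𝒫′ : List Route
    𝒫′ = 𝒫₁ ++ (P₁ ++ [ x ] , x) ∷ 𝒫₂

    Px-path : ABPath B′ (P₁ ++ [ x ] , x)
    Px-path with P-path
    ... | s , pathTo u l en =
      StartsIn-++ P₁ s ,
      pathTo (Unique-++⁻ˡ (P₁ ++ [ x ]) (subst Unique P≡ u))
             (Linked-++⁻ˡ (P₁ ++ [ x ]) (subst (Linked E) P≡ l))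
             (EndsIn-++⁺ P₁ (All.tabulate P₁-off) (stop (inj₂ (here refl))))
      where
      P₁-off : ∀ {w} → w ∈ P₁ → ¬ B′ w
      P₁-off w∈P₁ (inj₁ b) = All.lookup (EndsIn-prefix P₁ en) w∈P₁ b
      P₁-off w∈P₁ (inj₂ w∈tails) with ∈-++⁻ (x ∷ P₂) w∈tails
      ... | inj₁ w∈xP₂ = Unique-++⇒Disjoint P₁ u (w∈P₁ , w∈xP₂)
      ... | inj₂ w∈R₂  = R₂#P (w∈R₂ , ∈-++⁺ˡ w∈P₁)

    𝒫′-linkage : Linkage B′ 𝒫′
    𝒫′-linkage =
      All-++-∷⁺ 𝒫₁ Px-path (All.tabulate (λ a∈ → ABPath-widen tails (others#tails a∈) (All.lookup others-paths a∈))) ,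
      AllPairs-++-∷⁺ Disjoint.sym 𝒫₁ (All.map (Disjoint-⊆ˡ Px⊆P) P#others) others#
      where
      Px⊆P : P₁ ++ [ x ] ⊆ P
      Px⊆P w∈ = subst (_ ∈_) (sym P≡) (∈-++⁺ˡ w∈)

    𝒫′-length : length 𝒫′ ≡ length 𝒫
    𝒫′-length = trans (length-++-sucʳ 𝒫₁ _ 𝒫₂) (sym (length-++-sucʳ 𝒫₁ _ 𝒫₂))

    𝒫′-shorter : totalLength 𝒫′ < totalLength 𝒫
    𝒫′-shorter = totalLength-< 𝒫₁ (prefix-shorter (endsIn (proj₂ P-path)))
      where
      prefix-shorter : ∀ {Q₂} → EndsIn B (P₁ ++ x ∷ Q₂) e → length (P₁ ++ [ x ]) < length (P₁ ++ x ∷ Q₂)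
      prefix-shorter {[]}    en = ⊥-elim (x≢e (EndsIn-last P₁ en))
      prefix-shorter {_ ∷ _} _  =
        subst₂ _<_ (sym (length-++ P₁)) (sym (length-++ P₁)) (+-monoʳ-< (length P₁) (s≤s (s≤s z≤n)))

    module Complete
      (Qs₁ Qs₂ : List Route) (Y₁ Q₁ : List V) (y : V)
      (Y-path : ABPath B′ (Y₁ ++ [ y ] , y)) (Q-path : ABPath B′ (Q₁ ++ [ x ] , x))
      (others′-paths : All (ABPath B′) (Qs₁ ++ Qs₂))
      (Y#Q : Disjoint (Y₁ ++ [ y ]) (Q₁ ++ [ x ]))
      (Y#others′ : All (Disjoint (Y₁ ++ [ y ]) ∘ proj₁) (Qs₁ ++ Qs₂))
      (Q#others′ : All (Disjoint (Q₁ ++ [ x ]) ∘ proj₁) (Qs₁ ++ Qs₂))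
      (others′# : AllPairs (Disjoint on proj₁) (Qs₁ ++ Qs₂))
      (ends₁ : ends Qs₁ ≡ ends 𝒫₁) (ends₂ : ends Qs₂ ≡ ends 𝒫₂)
      where

      others′ : List Route
      others′ = Qs₁ ++ Qs₂

      ends-others′ : ends others′ ≡ ends others
      ends-others′ = trans (map-++ proj₂ Qs₁ Qs₂) (trans (cong₂ _++_ ends₁ ends₂) (sym (map-++ proj₂ 𝒫₁ 𝒫₂)))

      ends-others : All (λ z → B z × z ∉ tails) (ends others)
      ends-others = Allₚ.map⁺ (All.tabulate λ a∈ →
        let en = endsIn (proj₂ (All.lookup others-paths a∈))
        in EndsIn-target en , λ z∈tails → others#tails a∈ (EndsIn-∈ en , z∈tails))

      settled : All (λ Z → ABPath B Z × Disjoint (proj₁ Z) tails) others′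
      settled = All.zipWith settle (others′-paths , Allₚ.map⁻ (subst (All _) (sym ends-others′) ends-others))
        where
        settle : ∀ {Z} → ABPath B′ Z × (B (proj₂ Z) × proj₂ Z ∉ tails) → ABPath B Z × Disjoint (proj₁ Z) tails
        settle (path , b , z∉tails) =
          ABPath-narrow inj₁ b path ,
          λ (w∈Z , w∈tails) → z∉tails (subst (_∈ tails) (EndsIn-only (endsIn (proj₂ path)) w∈Z (inj₂ w∈tails)) w∈tails)

      within : ∀ Z {W} → W ⊆ Z ++ tails → All (Disjoint Z ∘ proj₁) others′ → All (Disjoint W ∘ proj₁) others′
      within Z W⊆ Z#others′ = All.tabulate λ a∈ (w∈W , w∈a) → avoid a∈ w∈a (∈-++⁻ Z (W⊆ w∈W))
        where
        avoid : ∀ {a w} → a ∈ others′ → w ∈ proj₁ a → w ∈ Z ⊎ w ∈ tails → ⊥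
        avoid a∈ w∈a (inj₁ w∈Z)     = All.lookup Z#others′ a∈ (w∈Z , w∈a)
        avoid a∈ w∈a (inj₂ w∈tails) = proj₂ (All.lookup settled a∈) (w∈a , w∈tails)

      glued-⊆ : ∀ U {z T} → T ⊆ tails → U ++ z ∷ T ⊆ (U ++ [ z ]) ++ tails
      glued-⊆ U T⊆ w∈ with ∈-++⁻ U w∈
      ... | inj₁ w∈U          = ∈-++⁺ˡ (∈-++⁺ˡ w∈U)
      ... | inj₂ (here refl)  = ∈-++⁺ˡ (∈-insert U)
      ... | inj₂ (there w∈T)  = ∈-++⁺ʳ (U ++ [ _ ]) (T⊆ w∈T)

      assemble : ∀ N′ P′ → ABPath B N′ → ABPath B (P′ , e) → Disjoint (proj₁ N′) P′ →
                 All (Disjoint (proj₁ N′) ∘ proj₁) others′ → All (Disjoint P′ ∘ proj₁) others′ → Augmentation B 𝒫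
      assemble N′ P′ N′-path P′-path N′#P′ N′#others′ P′#others′ =
        N′ , Qs₁ ++ (P′ , e) ∷ Qs₂ ,
        (N′-path ∷ All-++-∷⁺ Qs₁ P′-path (All.map proj₁ settled) ,
         All-++-∷⁺ Qs₁ N′#P′ N′#others′ ∷ AllPairs-++-∷⁺ Disjoint.sym Qs₁ P′#others′ others′#) ,
        trans (map-++ proj₂ Qs₁ _) (trans (cong₂ _++_ ends₁ (cong (e ∷_) ends₂)) (sym (map-++ proj₂ 𝒫₁ _)))

      Y₁#tails : Disjoint Y₁ tails
      Y₁#tails (w∈Y₁ , w∈tails) = All.lookup (EndsIn-prefix Y₁ (endsIn (proj₂ Y-path))) w∈Y₁ (inj₂ w∈tails)

      Q₁#tails : Disjoint Q₁ tails
      Q₁#tails (w∈Q₁ , w∈tails) = All.lookup (EndsIn-prefix Q₁ (endsIn (proj₂ Q-path))) w∈Q₁ (inj₂ w∈tails)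

      Y₁#Q₁ : Disjoint Y₁ Q₁
      Y₁#Q₁ (w∈Y₁ , w∈Q₁) = Y#Q (∈-++⁺ˡ w∈Y₁ , ∈-++⁺ˡ w∈Q₁)

      y∉Q₁ : y ∉ Q₁
      y∉Q₁ y∈Q₁ = Y#Q (∈-insert Y₁ , ∈-++⁺ˡ y∈Q₁)

      y≢x : y ≢ x
      y≢x refl = Y#Q (∈-insert Y₁ , ∈-insert Q₁)

      via-P₂ : y ∈ P₂ → Augmentation B 𝒫
      via-P₂ y∈P₂ with PathTo-from (P₁ ++ [ x ]) y∈P₂ (subst (λ q → PathTo B q e) P≡ (proj₂ P-path))
      ... | T , yT-path , yT⊆P₂ =
        assemble (Q₁ ++ x ∷ R₂ , eR) (Y₁ ++ y ∷ T)
          (glue tails Q₁ Q-path (PathTo-suffix R₁ (proj₂ R-path)) xR₂⊆tails)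
          (glue tails Y₁ Y-path yT-path (P₂⊆tails ∘ yT⊆P₂))
          (Disjoint-++ˡ (Disjoint-++ʳ (Disjoint.sym Y₁#Q₁) (λ (w∈Q₁ , w∈yT) → Q₁#tails (w∈Q₁ , P₂⊆tails (yT⊆P₂ w∈yT))))
                        (Disjoint-++ʳ (λ (w∈xR₂ , w∈Y₁) → Y₁#tails (w∈Y₁ , xR₂⊆tails w∈xR₂))
                                      (λ (w∈xR₂ , w∈yT) → xR₂#P₂ (w∈xR₂ , yT⊆P₂ w∈yT))))
          (within (Q₁ ++ [ x ]) (glued-⊆ Q₁ R₂⊆tails) Q#others′)
          (within (Y₁ ++ [ y ]) (glued-⊆ Y₁ (P₂⊆tails ∘ yT⊆P₂ ∘ there)) Y#others′)

      extend-Y : y ∉ x ∷ P₂ → ∃₂ λ T eN → ABPath B (Y₁ ++ y ∷ T , eN) × T ⊆ R₂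
      extend-Y y∉ with B? y
      ... | yes b = [] , y , ABPath-narrow inj₁ b Y-path , λ ()
      ... | no ¬b with EndsIn-target (endsIn (proj₂ Y-path))
      ...   | inj₁ b = ⊥-elim (¬b b)
      ...   | inj₂ y∈tails with ∈-++⁻ (x ∷ P₂) y∈tails
      ...     | inj₁ y∈xP₂ = ⊥-elim (y∉ y∈xP₂)
      ...     | inj₂ y∈R₂ with PathTo-from (R₁ ++ [ x ]) y∈R₂ (subst (λ q → PathTo B q eR) R≡ (proj₂ R-path))
      ...       | T , yT-path , yT⊆R₂ =
        T , eR , glue tails Y₁ Y-path yT-path (R₂⊆tails ∘ yT⊆R₂) , yT⊆R₂ ∘ there

      via-R : y ∉ x ∷ P₂ → Augmentation B 𝒫
      via-R y∉ with extend-Y y∉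
      ... | T , eN , N′-path , T⊆R₂ =
        assemble (Y₁ ++ y ∷ T , eN) (Q₁ ++ x ∷ P₂) N′-path
          (glue tails Q₁ Q-path (PathTo-suffix P₁ (proj₂ P-path)) ∈-++⁺ˡ)
          (Disjoint-++ˡ (Disjoint-++ʳ Y₁#Q₁ (λ (w∈Y₁ , w∈xP₂) → Y₁#tails (w∈Y₁ , ∈-++⁺ˡ w∈xP₂)))
                        (Disjoint-++ʳ yT#Q₁ yT#xP₂))
          (within (Y₁ ++ [ y ]) (glued-⊆ Y₁ (R₂⊆tails ∘ T⊆R₂)) Y#others′)
          (within (Q₁ ++ [ x ]) (glued-⊆ Q₁ P₂⊆tails) Q#others′)
        where
        yT#Q₁ : Disjoint (y ∷ T) Q₁
        yT#Q₁ (here refl , y∈Q₁) = y∉Q₁ y∈Q₁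
        yT#Q₁ (there w∈T , w∈Q₁) = Q₁#tails (w∈Q₁ , R₂⊆tails (T⊆R₂ w∈T))
        yT#xP₂ : Disjoint (y ∷ T) (x ∷ P₂)
        yT#xP₂ (here refl , y∈xP₂) = y∉ y∈xP₂
        yT#xP₂ (there w∈T , w∈xP₂) = R₂#P (T⊆R₂ w∈T , ∈-++⁺ʳ P₁ w∈xP₂)

      augmentation : Augmentation B 𝒫
      augmentation with y ∈? x ∷ P₂
      ... | yes (here y≡x)   = ⊥-elim (y≢x y≡x)
      ... | yes (there y∈P₂) = via-P₂ y∈P₂
      ... | no y∉            = via-R y∉

    reroute : Augmentation B′ 𝒫′ → Augmentation B 𝒫
    reroute ((Y , y) , Qs , ((Y-path ∷ Qs-paths) , (Y#Qs ∷ Qs#)) , ends-eq)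
      with map-≡-++-∷ proj₂ Qs (ends 𝒫₁) (trans ends-eq (map-++ proj₂ 𝒫₁ _))
    ... | Qs₁ , (Q , _) , Qs₂ , refl , ends₁ , refl , ends₂
      with All-++-∷⁻ Qs₁ Qs-paths | All-++-∷⁻ Qs₁ Y#Qs | AllPairs-++-∷⁻ Disjoint.sym Qs₁ Qs#
    ... | Q-path , others′-paths | Y#Q , Y#others′ | Q#others′ , others′#
      with EndsIn-split (endsIn (proj₂ Y-path)) | EndsIn-split (endsIn (proj₂ Q-path))
    ... | Y₁ , refl | Q₁ , refl =
      Complete.augmentation Qs₁ Qs₂ Y₁ Q₁ y Y-path Q-path others′-paths Y#Q Y#others′ Q#others′ others′# ends₁ ends₂

  missing-ends : ∀ 𝒫 {P₀} → AllPairs (Disjoint on proj₁) P₀ → length 𝒫 < length P₀ →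
                 ∃ λ (R : Route) → R ∈ P₀ × Disjoint (ends 𝒫) (proj₁ R)
  missing-ends 𝒫 {P₀} P₀# 𝒫<P₀
    with find (Pigeonhole.some-avoids (λ c z → z ∈ proj₁ c) (λ c z → z ∈? proj₁ c) (ends 𝒫) P₀
                 (AllPairs.map (λ c#d {_} _ z∈c z∈d → c#d (z∈c , z∈d)) P₀#)
                 (subst (_< length P₀) (sym (length-map proj₂ 𝒫)) 𝒫<P₀))
  ... | R , R∈P₀ , R-misses = R , R∈P₀ , λ (z∈ends , z∈R) → R-misses (Any.map (λ { refl → z∈R }) z∈ends)

  augment : ∀ {B} → Decidable B → ∀ 𝒫 {P₀} → Acc _<_ (totalLength 𝒫) →
            Linkage B 𝒫 → Linkage B P₀ → length 𝒫 < length P₀ → Augmentation B 𝒫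
  augment B? 𝒫 (acc shorter) 𝒫-linkage P₀-linkage@(P₀-paths , P₀#) 𝒫<P₀ with missing-ends 𝒫 P₀# 𝒫<P₀
  ... | (R , eR) , R∈P₀ , ends#R with lastSatisfying (On? 𝒫) R
  ... | inj₁ R-off =
    (R , eR) , 𝒫 ,
    (All.lookup P₀-paths R∈P₀ ∷ proj₁ 𝒫-linkage ,
     All.tabulate (λ a∈ (w∈R , w∈a) → All.lookup R-off w∈R (Any.map (λ { refl → w∈a }) a∈)) ∷ proj₂ 𝒫-linkage) ,
    refl
  ... | inj₂ (R₁ , x , R₂ , refl , x-on , R₂-off) with find x-on
  ... | (P , e) , P∈𝒫 , x∈P with ∈-∃++ P∈𝒫 | ∈-∃++ x∈P
  ... | 𝒫₁ , 𝒫₂ , refl | P₁ , P₂ , refl =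
    let open Reroute B? 𝒫₁ 𝒫₂ P₁ P₂ x e R₁ R₂ eR 𝒫-linkage (All.lookup P₀-paths R∈P₀) ends#R R₂-off
        P₀′ , P₀′-linkage , P₀′-length = truncate-linkage B′? inj₁ P₀-linkage
    in reroute (augment B′? 𝒫′ (shorter 𝒫′-shorter) 𝒫′-linkage P₀′-linkage
                        (subst₂ _<_ (sym 𝒫′-length) (sym P₀′-length) 𝒫<P₀))

  enlarge-within : ∀ {B} → Decidable B → ∀ fuel 𝒫 {P₀} → length P₀ ≤ fuel + length 𝒫 →
                   Linkage B 𝒫 → Linkage B P₀ → ∃ λ Q → Linkage B Q × length P₀ ≤ length Q × ends 𝒫 ⊆ ends Q
  enlarge-within B? fuel 𝒫 {P₀} bound 𝒫-linkage P₀-linkage with length P₀ ≤? length 𝒫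
  ... | yes P₀≤𝒫 = 𝒫 , 𝒫-linkage , P₀≤𝒫 , λ z∈ → z∈
  ... | no  P₀≰𝒫 with fuel
  ...   | zero      = ⊥-elim (P₀≰𝒫 bound)
  ...   | suc fuel′ with augment B? 𝒫 (<-wellFounded _) 𝒫-linkage P₀-linkage (≰⇒> P₀≰𝒫)
  ...     | N , Qs , linkage , ends-eq with enlarge-within B? fuel′ (N ∷ Qs) bound′ linkage P₀-linkage
    where
    bound′ : length P₀ ≤ fuel′ + length (N ∷ Qs)
    bound′ rewrite +-suc fuel′ (length Qs) | sym (length-map proj₂ Qs) | ends-eq | length-map proj₂ 𝒫 = bound
  ...       | Q , Q-linkage , P₀≤Q , ends⊆ = Q , Q-linkage , P₀≤Q , ends⊆ ∘ there ∘ subst (_ ∈_) (sym ends-eq)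

  enlarge : ∀ {B} → Decidable B → ∀ {𝒫 P₀} → Linkage B 𝒫 → Linkage B P₀ →
            ∃ λ Q → Linkage B Q × length P₀ ≤ length Q × ends 𝒫 ⊆ ends Q
  enlarge B? {𝒫} {P₀} = enlarge-within B? (length P₀) 𝒫 (m≤m+n (length P₀) (length 𝒫))

-- inj₁ u is an inner copy of u and inj₂ u a sink entered from inj₁ u when uv is an edge, so the
-- (r,v)-path r a … u v corresponds to the path inj₁ a … inj₁ u, inj₂ u, whose end records its last edge.
module SplitDigraph {n : ℕ} (r v : Fin n) (v≢r : v ≢ r) (E : ERel n) (¬Erv : ¬ E r v) where

  Split : Set
  Split = Fin n ⊎ Fin n

  Inner : Fin n → Set
  Inner u = u ≢ r × u ≢ v

  E′ : Split → Split → Set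
  E′ (inj₁ a) (inj₁ b) = E a b × Inner b
  E′ (inj₁ a) (inj₂ b) = a ≡ b × E b v
  E′ (inj₂ _) _        = ⊥

  Start : Pred Split 0ℓ
  Start (inj₁ a) = E r a × Inner a
  Start (inj₂ _) = ⊥

  Sink : Pred Split 0ℓ
  Sink (inj₁ _) = ⊥
  Sink (inj₂ _) = ⊤

  Sink? : Decidable Sink
  Sink? (inj₁ _) = no λ ()
  Sink? (inj₂ _) = yes tt

  open Linkages (⊎-≡-dec _≟ᶠ_ _≟ᶠ_) E′ Start
  open PathTo

  split : List (Fin n) → List Split
  split []           = []
  split (a ∷ [])     = inj₁ a ∷ inj₂ a ∷ []
  split (a ∷ b ∷ ms) = inj₁ a ∷ split (b ∷ ms)

  lastOf : Fin n → List (Fin n) → Fin n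
  lastOf a []       = a
  lastOf a (b ∷ ms) = lastOf b ms

  lastOf-∷ʳ : ∀ a ms → ∃ λ init → a ∷ ms ≡ init ∷ʳ lastOf a ms
  lastOf-∷ʳ a []       = [] , refl
  lastOf-∷ʳ a (b ∷ ms) with lastOf-∷ʳ b ms
  ... | init , eq = a ∷ init , cong (a ∷_) eq

  ∈-split⁻ : ∀ a ms {w} → w ∈ split (a ∷ ms) → ∃ λ u → u ∈ a ∷ ms × (w ≡ inj₁ u ⊎ w ≡ inj₂ u)
  ∈-split⁻ a []       (here refl)         = a , here refl , inj₁ refl
  ∈-split⁻ a []       (there (here refl)) = a , here refl , inj₂ refl
  ∈-split⁻ a (b ∷ ms) (here refl)         = a , here refl , inj₁ refl
  ∈-split⁻ a (b ∷ ms) (there w∈)          with ∈-split⁻ b ms w∈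
  ... | u , u∈ , w≡ = u , there u∈ , w≡

  split-path : ∀ a ms → All Inner (a ∷ ms) → Unique (a ∷ ms) → Linked E ((a ∷ ms) ++ [ v ]) →
               PathTo Sink (split (a ∷ ms)) (inj₂ (lastOf a ms))
  split-path a []       _ _ (Eav ∷ [-]) =
    pathTo (((λ ()) ∷ []) ∷ [] ∷ []) ((refl , Eav) ∷ [-]) (skip (λ ()) (stop tt))
  split-path a (b ∷ ms) (_ ∷ inner) (a∉ ∷ uniq) (Eab ∷ linked) with split-path b ms inner uniq linked
  ... | pathTo uniq′ linked′ ends′ =
    pathTo (All.tabulate a-fresh ∷ uniq′) (link ms linked′) (skip (λ ()) ends′)
    where
    a-fresh : ∀ {w} → w ∈ split (b ∷ ms) → inj₁ a ≢ w
    a-fresh w∈ a≡w with ∈-split⁻ b ms w∈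
    ... | u , u∈ , inj₁ refl = All.lookup a∉ u∈ (inj₁-injective a≡w)
    ... | u , u∈ , inj₂ refl with a≡w
    ... | ()
    link : ∀ ms′ → Linked E′ (split (b ∷ ms′)) → Linked E′ (inj₁ a ∷ split (b ∷ ms′))
    link []      l = (Eab , All.lookup inner (here refl)) ∷ l
    link (_ ∷ _) l = (Eab , All.lookup inner (here refl)) ∷ l

  path-shape : ∀ {p} → IsPath E r v p → ∃₂ λ a ms → p ≡ r ∷ (a ∷ ms) ++ [ v ]
  path-shape path with IsPath.start path | IsPath.end path | IsPath.edges path
  ... | rest , refl | []         , eq | _ = ⊥-elim (v≢r (sym (proj₁ (∷-injective eq))))
  ... | rest , refl | _ ∷ []     , eq | edges with ∷-injective eq
  ...   | refl , refl with edges
  ...     | Erv ∷ _ = ⊥-elim (¬Erv Erv)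
  path-shape path | rest , refl | _ ∷ a ∷ ms , eq | _ with ∷-injective eq
  ...   | refl , refl = a , ms , refl

  record Encodes (p : List (Fin n)) (c : Route) : Set where
    field
      copies   : ∀ {w} → w ∈ proj₁ c → ∃ λ u → u ∈ p × Inner u × (w ≡ inj₁ u ⊎ w ≡ inj₂ u)
      lastEdge : ∀ {u w} → EndsWith p (u , w) → proj₂ c ≡ inj₂ u × w ≡ v
  open Encodes

  encode : ∀ {p} → IsPath E r v p → ∃ λ c → ABPath Sink c × Encodes p c
  encode path with path-shape path
  ... | a , ms , refl with IsPath.distinct path | IsPath.edges path
  ... | r∉ ∷ uniq | Era ∷ linked =
    (split (a ∷ ms) , inj₂ (lastOf a ms)) , (start ms , split-path a ms inner (Unique-++⁻ˡ (a ∷ ms) uniq) linked) ,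
    record { copies = copies′ ; lastEdge = lastEdge′ }
    where
    inner : All Inner (a ∷ ms)
    inner = All.tabulate λ u∈ → (λ { refl → All.lookup r∉ (∈-++⁺ˡ u∈) refl })
                              , (λ { refl → Unique-++⇒Disjoint (a ∷ ms) uniq (u∈ , here refl) })
    start : ∀ ms′ → StartsIn (split (a ∷ ms′))
    start []      = Era , All.lookup inner (here refl)
    start (_ ∷ _) = Era , All.lookup inner (here refl)
    copies′ : ∀ {w} → w ∈ split (a ∷ ms) → ∃ λ u → u ∈ r ∷ (a ∷ ms) ++ [ v ] × Inner u × (w ≡ inj₁ u ⊎ w ≡ inj₂ u)
    copies′ w∈ with ∈-split⁻ a ms w∈
    ... | u , u∈ , w≡ = u , there (∈-++⁺ˡ u∈) , All.lookup inner u∈ , w≡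
    lastEdge′ : ∀ {u w} → EndsWith (r ∷ (a ∷ ms) ++ [ v ]) (u , w) → inj₂ (lastOf a ms) ≡ inj₂ u × w ≡ v
    lastEdge′ (init , eq) with lastOf-∷ʳ a ms
    ... | init′ , eq′ with last-two-injective init (r ∷ init′) (trans (sym eq)
           (trans (cong (λ l → r ∷ l ++ [ v ]) eq′) (cong (r ∷_) (++-assoc init′ [ lastOf a ms ] [ v ]))))
    ... | u≡ , w≡ = cong inj₂ (sym u≡) , w≡

  encodes-disjoint : ∀ {p q c d} → InternallyDisjoint r v p q → Encodes p c → Encodes q d → Disjoint (proj₁ c) (proj₁ d)
  encodes-disjoint {q = q} p∩q enc-c enc-d (w∈c , w∈d) with copies enc-c w∈c | copies enc-d w∈d
  ... | u , u∈p , (u≢r , u≢v) , w≡u | u′ , u′∈q , _ , w≡u′ = shared w≡u w≡u′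
    where
    not-shared : u ∈ q → ⊥
    not-shared u∈q with p∩q u u∈p u∈q
    ... | inj₁ u≡r = u≢r u≡r
    ... | inj₂ u≡v = u≢v u≡v
    shared : ∀ {w} → (w ≡ inj₁ u ⊎ w ≡ inj₂ u) → (w ≡ inj₁ u′ ⊎ w ≡ inj₂ u′) → ⊥
    shared (inj₁ refl) (inj₁ eq) = not-shared (subst (_∈ _) (sym (inj₁-injective eq)) u′∈q)
    shared (inj₂ refl) (inj₂ eq) = not-shared (subst (_∈ _) (sym (inj₂-injective eq)) u′∈q)
    shared (inj₁ refl) (inj₂ ())
    shared (inj₂ refl) (inj₁ ())

  encode-all : ∀ {P} → All (IsPath E r v) P → ∃ λ F → All (ABPath Sink) F × Pointwise Encodes P F
  encode-all []             = [] , [] , []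
  encode-all (path ∷ paths) with encode path | encode-all paths
  ... | c , c-path , enc | F , F-paths , encs = c ∷ F , c-path ∷ F-paths , enc ∷ encs

  encodes-disjoint-all : ∀ {p c Ps Fs} → Encodes p c → All (InternallyDisjoint r v p) Ps → Pointwise Encodes Ps Fs →
                         All (Disjoint (proj₁ c) ∘ proj₁) Fs
  encodes-disjoint-all enc []         []           = []
  encodes-disjoint-all enc (p∩q ∷ ps) (enc′ ∷ encs) = encodes-disjoint p∩q enc enc′ ∷ encodes-disjoint-all enc ps encs

  encode-system : ∀ {P} → PathSystem E r v P →
    ∃ λ F → Linkage Sink F × length F ≡ length P × (∀ {u w} → E⁺ P (u , w) → w ≡ v × inj₂ u ∈ ends F)
  encode-system (paths , pairs) with encode-all paths
  ... | F , F-paths , encs = F , (F-paths , disjoint pairs encs) , sym (Pointwise-length encs) , last-edges encs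
    where
    disjoint : ∀ {P F} → AllPairs (λ p q → p ≢ q × InternallyDisjoint r v p q) P → Pointwise Encodes P F →
               AllPairs (Disjoint on proj₁) F
    disjoint []           []           = []
    disjoint (p# ∷ pairs) (enc ∷ encs) = encodes-disjoint-all enc (All.map proj₂ p#) encs ∷ disjoint pairs encs
    last-edges : ∀ {P F u w} → Pointwise Encodes P F → E⁺ P (u , w) → w ≡ v × inj₂ u ∈ ends F
    last-edges (enc ∷ _)    (here ends-uw) with lastEdge enc ends-uw
    ... | c≡ , w≡ = w≡ , here (sym c≡)
    last-edges (_ ∷ encs) (there in-P) = ×-map₂ there (last-edges encs in-P)

  inners : List Split → List (Fin n)
  inners []            = []
  inners (inj₁ a ∷ ws) = a ∷ inners ws
  inners (inj₂ _ ∷ _)  = []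

  decode : Route → List (Fin n)
  decode (ws , _) = r ∷ inners ws ++ [ v ]

  ∈-inners⁻ : ∀ ws {u} → u ∈ inners ws → inj₁ u ∈ ws
  ∈-inners⁻ (inj₁ a ∷ ws) (here refl) = here refl
  ∈-inners⁻ (inj₁ a ∷ ws) (there u∈)  = there (∈-inners⁻ ws u∈)

  inners-unique : ∀ ws → Unique ws → Unique (inners ws)
  inners-unique []            _           = []
  inners-unique (inj₁ a ∷ ws) (a∉ ∷ uniq) =
    All.tabulate (λ u∈ a≡u → All.lookup a∉ (∈-inners⁻ ws u∈) (cong inj₁ a≡u)) ∷ inners-unique ws uniq
  inners-unique (inj₂ _ ∷ ws) _           = []

  inners-inner : ∀ a ws → Inner a → Linked E′ (inj₁ a ∷ ws) → All Inner (a ∷ inners ws)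
  inners-inner a []             inner _                      = inner ∷ []
  inners-inner a (inj₁ b ∷ ws)  inner ((_ , inner′) ∷ linked) = inner ∷ inners-inner b ws inner′ linked
  inners-inner a (inj₂ _ ∷ _)   inner _                      = inner ∷ []

  inners-linked : ∀ a ws {e} → EndsIn Sink (inj₁ a ∷ ws) e → Linked E′ (inj₁ a ∷ ws) →
    Linked E (a ∷ inners ws ++ [ v ]) × ∃₂ λ init b → e ≡ inj₂ b × a ∷ inners ws ≡ init ++ [ b ]
  inners-linked a []                 (skip _ ())          _
  inners-linked a (inj₂ b ∷ [])      (skip _ (stop tt))   ((refl , Ebv) ∷ _) = Ebv ∷ [-] , [] , b , refl , refl
  inners-linked a (inj₂ b ∷ _ ∷ _)   (skip _ (skip ¬s _)) _                  = ⊥-elim (¬s tt)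
  inners-linked a (inj₁ a′ ∷ ws)     (skip _ ends)        ((Eaa′ , _) ∷ linked) with inners-linked a′ ws ends linked
  ... | linked′ , init , b , e≡ , split≡ = Eaa′ ∷ linked′ , a ∷ init , b , e≡ , cong (a ∷_) split≡

  ∈-decode⁻ : ∀ ws {u} → u ∈ r ∷ inners ws ++ [ v ] → u ≡ r ⊎ u ≡ v ⊎ inj₁ u ∈ ws
  ∈-decode⁻ ws (here refl) = inj₁ refl
  ∈-decode⁻ ws (there u∈)  with ∈-++⁻ (inners ws) u∈
  ... | inj₁ u∈inners    = inj₂ (inj₂ (∈-inners⁻ ws u∈inners))
  ... | inj₂ (here refl) = inj₂ (inj₁ refl)

  decode-path : ∀ {c} → ABPath Sink c →
                IsPath E r v (decode c) × (∀ {b} → proj₂ c ≡ inj₂ b → EndsWith (decode c) (b , v))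
  decode-path {[]          , _} (() , _)
  decode-path {inj₂ _ ∷ _  , _} (() , _)
  decode-path {inj₁ a ∷ ws , e} ((Era , inner) , pathTo uniq linked ends) with inners-linked a ws ends linked
  ... | linked′ , init , b , e≡ , split≡ =
    record { distinct = All.tabulate r-fresh ∷ Unique.++⁺ (inners-unique (inj₁ a ∷ ws) uniq) ([] ∷ []) v-fresh
           ; start    = _ , refl
           ; end      = r ∷ a ∷ inners ws , refl
           ; edges    = Era ∷ linked′ } ,
    λ e≡′ → r ∷ init , last-edge e≡′
    where
    inner′ : All Inner (a ∷ inners ws)
    inner′ = inners-inner a ws inner linked
    r-fresh : ∀ {w} → w ∈ (a ∷ inners ws) ++ [ v ] → r ≢ w
    r-fresh w∈ r≡w with ∈-++⁻ (a ∷ inners ws) w∈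
    ... | inj₁ w∈inner    = proj₁ (All.lookup inner′ w∈inner) (sym r≡w)
    ... | inj₂ (here refl) = v≢r (sym r≡w)
    v-fresh : Disjoint (a ∷ inners ws) [ v ]
    v-fresh (w∈ , here refl) = proj₂ (All.lookup inner′ w∈) refl
    last-edge : ∀ {b′} → e ≡ inj₂ b′ → r ∷ (a ∷ inners ws) ++ [ v ] ≡ (r ∷ init) ++ b′ ∷ v ∷ []
    last-edge e≡′ with trans (sym e≡) e≡′
    ... | refl = cong (r ∷_) (trans (cong (_++ [ v ]) split≡) (++-assoc init [ b ] [ v ]))

  decode-pair : ∀ {c d} → ABPath Sink c → Disjoint (proj₁ c) (proj₁ d) →
                decode c ≢ decode d × InternallyDisjoint r v (decode c) (decode d)
  decode-pair {[]          , _} (() , _)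
  decode-pair {inj₂ _ ∷ _  , _} (() , _)
  decode-pair {inj₁ a ∷ ws , _} {ws′ , _} ((_ , a≢r , a≢v) , _) c#d = differ , internally
    where
    internally : InternallyDisjoint r v (r ∷ inners (inj₁ a ∷ ws) ++ [ v ]) (r ∷ inners ws′ ++ [ v ])
    internally u u∈c u∈d with ∈-decode⁻ (inj₁ a ∷ ws) u∈c | ∈-decode⁻ ws′ u∈d
    ... | inj₁ u≡r         | _                = inj₁ u≡r
    ... | inj₂ (inj₁ u≡v)  | _                = inj₂ u≡v
    ... | _                | inj₁ u≡r         = inj₁ u≡r
    ... | _                | inj₂ (inj₁ u≡v)  = inj₂ u≡v
    ... | inj₂ (inj₂ u∈c′) | inj₂ (inj₂ u∈d′) = ⊥-elim (c#d (u∈c′ , u∈d′))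
    differ : r ∷ inners (inj₁ a ∷ ws) ++ [ v ] ≢ r ∷ inners ws′ ++ [ v ]
    differ eq with ∈-decode⁻ ws′ (subst (a ∈_) eq (there (here refl)))
    ... | inj₁ a≡r         = a≢r a≡r
    ... | inj₂ (inj₁ a≡v)  = a≢v a≡v
    ... | inj₂ (inj₂ a∈d)  = c#d (here refl , a∈d)

  decode-system : ∀ {F} → Linkage Sink F → PathSystem E r v (map decode F)
  decode-system (paths , pairs) =
    Allₚ.map⁺ (All.map (proj₁ ∘ decode-path) paths) , AllPairsₚ.map⁺ (decode-pairs paths pairs)
    where
    decode-pairs : ∀ {F} → All (ABPath Sink) F → AllPairs (Disjoint on proj₁) F →
                   AllPairs (λ c d → decode c ≢ decode d × InternallyDisjoint r v (decode c) (decode d)) F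
    decode-pairs []               []         = []
    decode-pairs (c-path ∷ paths) (c# ∷ F#) = All.map (λ {d} → decode-pair {d = d} c-path) c# ∷ decode-pairs paths F#

  decode-E⁺ : ∀ {F u} → All (ABPath Sink) F → inj₂ u ∈ ends F → E⁺ (map decode F) (u , v)
  decode-E⁺ paths u∈ with ∈-map⁻ proj₂ u∈
  ... | c , c∈F , u≡ = Anyₚ.map⁺ (Any.map (λ { refl → proj₂ (decode-path (All.lookup paths c∈F)) (sym u≡) }) c∈F)

  extend : ∀ {Q P₀} → PathSystem E r v Q → PathSystem E r v P₀ →
           ∃ λ Q′ → PathSystem E r v Q′ × length P₀ ≤ length Q′ × E⁺ Q ⊆E E⁺ Q′
  extend Q-system P₀-system with encode-system Q-system | encode-system P₀-system
  ... | FQ , FQ-linkage , _ , FQ-ends | F₀ , F₀-linkage , F₀-length , _ with enlarge Sink? FQ-linkage F₀-linkage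
  ... | 𝒬 , 𝒬-linkage , F₀≤𝒬 , ends⊆ =
    map decode 𝒬 , decode-system 𝒬-linkage ,
    ≤-trans (≤-reflexive (sym F₀-length)) (≤-trans F₀≤𝒬 (≤-reflexive (sym (length-map decode 𝒬)))) ,
    λ { (u , w) uw∈ → last-edge (FQ-ends uw∈) }
    where
    last-edge : ∀ {u w} → w ≡ v × inj₂ u ∈ ends FQ → E⁺ (map decode 𝒬) (u , w)
    last-edge (refl , u∈) = decode-E⁺ (proj₁ 𝒬-linkage) (ends⊆ u∈)

module _ {n : ℕ} {r v : Fin n} where

  IsPath-mono : ∀ {R R′ : ERel n} → (∀ {x y} → R x y → R′ x y) → ∀ {p} → IsPath R r v p → IsPath R′ r v p
  IsPath-mono R⊆R′ path = record
    { distinct = IsPath.distinct path ; start = IsPath.start path ; end = IsPath.end path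
    ; edges = Linked.map R⊆R′ (IsPath.edges path) }

  PathSystem-mono : ∀ {R R′ : ERel n} → (∀ {x y} → R x y → R′ x y) → ∀ {P} → PathSystem R r v P → PathSystem R′ r v P
  PathSystem-mono R⊆R′ (paths , pairs) = All.map (IsPath-mono R⊆R′) paths , pairs

  Separation-antimono : ∀ {R R′ : ERel n} → (∀ {x y} → R x y → R′ x y) →
                        ∀ {S} → Separation R′ r v S → Separation R r v S
  Separation-antimono R⊆R′ (avoids-rv , meets) = avoids-rv , λ p path → meets p (IsPath-mono R⊆R′ path)

  PathSystem-within : ∀ {R R′ : ERel n} {P} → PathSystem (R ∖e (r , v)) r v P → All (Linked R′) P →
                      PathSystem (R′ ∖e (r , v)) r v P
  PathSystem-within (paths , pairs) in-R′ = All.zipWith restrict (paths , in-R′) , pairs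
    where
    restrict : ∀ {R R′ : ERel n} {p} → IsPath (R ∖e (r , v)) r v p × Linked R′ p → IsPath (R′ ∖e (r , v)) r v p
    restrict (path , linked) = record
      { distinct = IsPath.distinct path ; start = IsPath.start path ; end = IsPath.end path
      ; edges = Linked-zipWith (λ R′xy (_ , not-rv) → R′xy , not-rv) linked (IsPath.edges path) }

  RV : List (Fin n)
  RV = r ∷ v ∷ []

  not-RV : ∀ {R : ERel n} {p} → IsPath (R ∖e (r , v)) r v p → p ≢ RV
  not-RV path refl = proj₂ (Linked.head (IsPath.edges path)) (refl , refl)

  Linked-∖e : ∀ {R : ERel n} {xs} → All (r ≢_) xs → Linked R xs → Linked (R ∖e (r , v)) xs
  Linked-∖e _            []             = []
  Linked-∖e _            [-]            = [-]
  Linked-∖e (r≢x ∷ r≢xs) (Rxy ∷ linked) = (Rxy , λ (x≡r , _) → r≢x (sym x≡r)) ∷ Linked-∖e r≢xs linked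

  IsPath-∖e : ∀ {R : ERel n} {p} → IsPath R r v p → p ≢ RV → IsPath (R ∖e (r , v)) r v p
  IsPath-∖e path p≢RV with IsPath.start path | IsPath.end path | IsPath.edges path | IsPath.distinct path
  ... | [] , refl | _ | _ | _ =
    record { distinct = IsPath.distinct path ; start = IsPath.start path ; end = IsPath.end path ; edges = [-] }
  ... | y ∷ rest , refl | init , p≡ | Rry ∷ linked | r∉ ∷ (y∉ ∷ _) =
    record { distinct = IsPath.distinct path ; start = IsPath.start path ; end = IsPath.end path
           ; edges = (Rry , first-edge init p≡) ∷ Linked-∖e r∉ linked }
    where
    first-edge : ∀ init → r ∷ y ∷ rest ≡ init ∷ʳ v → ¬ (r ≡ r × y ≡ v)
    first-edge []           ()
    first-edge (_ ∷ init′) p≡ (_ , refl) with ∷-≡-∷ʳ init′ (proj₂ (∷-injective p≡))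
    ... | inj₁ refl  = p≢RV refl
    ... | inj₂ v∈rest = All.lookup y∉ v∈rest refl

  not-RV? : (p : List (Fin n)) → Dec (¬ p ≡ RV)
  not-RV? p = ¬? (≡-dec _≟ᶠ_ p RV)

  PathSystem-removeRV : ∀ {R : ERel n} {P} → PathSystem R r v P → PathSystem (R ∖e (r , v)) r v (removeRV r v P)
  PathSystem-removeRV {P = P} (paths , pairs) =
    All.zipWith (λ (p≢RV , path) → IsPath-∖e path p≢RV) (Allₚ.all-filter not-RV? P , Allₚ.filter⁺ not-RV? paths) ,
    AllPairsₚ.filter⁺ not-RV? pairs

  removeRV-∖e : ∀ {R : ERel n} {Q} → PathSystem (R ∖e (r , v)) r v Q → removeRV r v Q ≡ Q
  removeRV-∖e (paths , _) = filter-all not-RV? (All.map not-RV paths)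

  E⁺-removeRV⁻ : ∀ {P u w} → E⁺ P (u , w) → E⁺ (removeRV r v P) (u , w) ⊎ (u , w) ≡ (r , v)
  E⁺-removeRV⁻ e∈ with find e∈
  ... | p , p∈P , ends-uw with ≡-dec _≟ᶠ_ p RV
  ... | no p≢RV  = inj₁ (lose (∈-filter⁺ not-RV? p∈P p≢RV) ends-uw)
  ... | yes refl with ends-uw
  ...   | init , eq with last-two-injective [] init eq
  ...     | refl , refl = inj₂ refl

  E⁺-edge : ∀ {R : ERel n} {P u w} → All (IsPath R r v) P → E⁺ P (u , w) → R u w
  E⁺-edge paths e∈ with find e∈
  ... | p , p∈P , (init , refl) = Linked.head (Linked-++⁻ʳ init (IsPath.edges (All.lookup paths p∈P)))

  E⁺-restored : ∀ {H : Digraph n} {Q P} → PathSystem (Edge H) r v Q → E⁺ (removeRV r v Q) ⊆E E⁺ P →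
                (Edge H r v → E⁺ P (r , v)) → E⁺ Q ⊆E E⁺ P
  E⁺-restored (paths , _) kept rv-kept (u , w) uw∈ with E⁺-removeRV⁻ uw∈
  ... | inj₁ uw∈′ = kept _ uw∈′
  ... | inj₂ refl = rv-kept (E⁺-edge paths uw∈)

  restoreRV : ∀ (H : Digraph n) {Q} → v ≢ r → PathSystem (Edge H ∖e (r , v)) r v Q →
    ∃ λ P → PathSystem (Edge H) r v P × removeRV r v P ≡ Q × E⁺ Q ⊆E E⁺ P × (Edge H r v → E⁺ P (r , v))
  restoreRV H {Q} v≢r Q-system@(paths , pairs) with adj H r v in rv∈H
  ... | true  =
    RV ∷ Q , (RV-path ∷ All.map (IsPath-mono proj₁) paths , All.map RV-apart paths ∷ pairs) ,
    trans (filter-reject not-RV? (λ ¬RV≡RV → ¬RV≡RV refl)) (removeRV-∖e Q-system) ,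
    (λ _ → there) , (λ _ → here ([] , refl))
    where
    RV-path : IsPath (Edge H) r v RV
    RV-path = record { distinct = ((λ r≡v → v≢r (sym r≡v)) ∷ []) ∷ [] ∷ [] ; start = _ , refl
                     ; end = [ r ] , refl ; edges = rv∈H ∷ [-] }
    RV-apart : ∀ {q} → IsPath (Edge H ∖e (r , v)) r v q → RV ≢ q × InternallyDisjoint r v RV q
    RV-apart path = (λ RV≡q → not-RV path (sym RV≡q)) ,
                    λ { _ (here refl) _ → inj₁ refl ; _ (there (here refl)) _ → inj₂ refl }
  ... | false =
    Q , PathSystem-mono proj₁ Q-system , removeRV-∖e Q-system , (λ _ uw∈ → uw∈) , λ ()

-- X lists S with |P₀| entries. A vertex s of S missed by Q, or a path of Q meeting S in x ≠ y,
-- would give |Q| + 1 lists pairwise separated on X and each meeting X (add [ s ], resp. replace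
-- the path by [ x ] and [ y ]), beating the pigeonhole bound.
module Orthogonality {n : ℕ} {R : ERel n} {r v : Fin n} {S : VSet n} (S-sep : Separation R r v S)
                     {P₀} (P₀⊥S : Orthogonal P₀ S) {Q} (Q-system : PathSystem R r v Q) (P₀≤Q : length P₀ ≤ length Q)
                     where

  open Pigeonhole {V = Fin n} {C = List (Fin n)} (λ c z → z ∈ c)
  open import Data.List.Membership.DecPropositional (_≟ᶠ_ {n}) using (_∈?_)

  X : List (Fin n)
  X = All.reduce proj₁ (proj₁ P₀⊥S)

  X⊆S : All S X
  X⊆S = All-reduce proj₁ (proj₁ ∘ proj₂ ∘ proj₂) (proj₁ P₀⊥S)

  S⊆X : ∀ {s} → S s → s ∈ X
  S⊆X {s} Ss with find (proj₂ P₀⊥S s Ss)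
  ... | p , p∈P₀ , s∈p with All.lookup (proj₁ P₀⊥S) p∈P₀ in rep
  ... | x , _ , _ , only =
    subst (_∈ X) (sym (only s s∈p Ss)) (subst (λ w → proj₁ w ∈ X) rep (∈-reduce proj₁ (proj₁ P₀⊥S) p∈P₀))

  S-inner : ∀ {z} → S z → z ≡ r ⊎ z ≡ v → ⊥
  S-inner Sz (inj₁ z≡r) = proj₁ (proj₁ S-sep _ Sz) z≡r
  S-inner Sz (inj₂ z≡v) = proj₂ (proj₁ S-sep _ Sz) z≡v

  separated : AllPairs (SeparatedOn X) Q
  separated =
    AllPairs.map (λ (_ , p∩q) {_} z∈X z∈p z∈q → S-inner (All.lookup X⊆S z∈X) (p∩q _ z∈p z∈q)) (proj₂ Q-system)

  hit : ∀ {q} → q ∈ Q → ∃ λ x → x ∈ q × S x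
  hit q∈ = proj₂ S-sep _ (All.lookup (proj₁ Q-system) q∈)

  meets : All (Meets X) Q
  meets = All.tabulate λ q∈ → let x , x∈q , Sx = hit q∈ in lose (S⊆X Sx) x∈q

  no-more-than-Q : ∀ F → AllPairs (SeparatedOn X) F → All (Meets X) F → length Q < length F → ⊥
  no-more-than-Q F F# F-meets Q<F =
    <⇒≱ (≤-trans (s≤s (≤-trans (≤-reflexive (length-reduce proj₁ (proj₁ P₀⊥S))) P₀≤Q)) Q<F) (pigeonhole F F# F-meets)

  covered : ∀ s → S s → Any (s ∈_) Q
  covered s Ss with Any.any? (s ∈?_) Q
  ... | yes s∈Q = s∈Q
  ... | no  s∉Q = ⊥-elim (no-more-than-Q ([ s ] ∷ Q)
                            (All.tabulate (λ { q∈ _ (here refl) s∈q → s∉Q (lose q∈ s∈q) }) ∷ separated)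
                            (lose (S⊆X Ss) (here refl) ∷ meets)
                            (n<1+n _))

  hit-once : ∀ {q} → q ∈ Q → ∃ λ x → x ∈ q × S x × (∀ y → y ∈ q → S y → y ≡ x)
  hit-once {q} q∈ with hit q∈
  ... | x , x∈q , Sx = x , x∈q , Sx , only
    where
    only : ∀ y → y ∈ q → S y → y ≡ x
    only y y∈q Sy with y ≟ᶠ x
    ... | yes y≡x = y≡x
    ... | no  y≢x with ∈-∃++ q∈
    ... | Q₁ , Q₂ , refl with AllPairs-++-∷⁻ SeparatedOn-sym Q₁ separated | All-++-∷⁻ Q₁ meets
    ... | q#others , others# | _ , others-meet = ⊥-elim $
      no-more-than-Q ([ x ] ∷ [ y ] ∷ Q₁ ++ Q₂)
        (((λ { _ (here refl) (here x≡y) → y≢x (sym x≡y) }) ∷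
          All.map (λ { q#q′ z∈X (here refl) → q#q′ z∈X x∈q }) q#others) ∷
         All.map (λ { q#q′ z∈X (here refl) → q#q′ z∈X y∈q }) q#others ∷
         others#)
        (lose (S⊆X Sx) (here refl) ∷ lose (S⊆X Sy) (here refl) ∷ others-meet)
        (s≤s (≤-reflexive (length-++-sucʳ Q₁ q Q₂)))

  orthogonal : Orthogonal Q S
  orthogonal = All.tabulate hit-once , covered

corollary2p6 : ∀ {n : ℕ} (D L : Digraph n) (r v : Fin n) → v ≢ r →
    Large D L r v →
    ∀ (I : EdgeSet n) → 𝒢 L r v I →
      Σ _ λ P → PathSystem (Edge L) r v P ×
        𝔓 D r v (removeRV r v P) × 𝔓 L r v (removeRV r v P) ×
        (I ⊆E E⁺ P)
corollary2p6 D L r v v≢r (L⊆D , (P₀ , (P₀-system , S , S-sep , P₀⊥S) , P₀-in-L) , _) I (_ , Q , Q-system , I⊆E⁺Q , _) =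
  let Q′ , Q′-system , P₀≤Q′ , Q₀-kept =
        SplitDigraph.extend r v v≢r (Edge L ∖e (r , v)) (λ (_ , not-rv) → not-rv (refl , refl))
                            (PathSystem-removeRV Q-system) (PathSystem-within P₀-system P₀-in-L)
      P , P-system , P≡Q′ , Q′-kept , rv-kept = restoreRV L v≢r Q′-system
      Q′-in-D = PathSystem-mono L⇒D Q′-system
      Q′⊥S = Orthogonality.orthogonal S-sep P₀⊥S Q′-in-D P₀≤Q′
  in P , P-system ,
     subst (𝔓 D r v) (sym P≡Q′) (Q′-in-D , S , S-sep , Q′⊥S) ,
     subst (𝔓 L r v) (sym P≡Q′) (Q′-system , S , Separation-antimono L⇒D S-sep , Q′⊥S) ,
     λ e e∈I → E⁺-restored {H = L} Q-system (λ e → Q′-kept e ∘ Q₀-kept e) rv-kept e (I⊆E⁺Q e e∈I)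
  where
  L⇒D : ∀ {x y} → (Edge L ∖e (r , v)) x y → (Edge D ∖e (r , v)) x y
  L⇒D (Lxy , not-rv) = L⊆D _ _ Lxy , not-rv
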